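{- Let $T$ be a rectangular tableau with $r+1$ rows and $s$ columns and entries in $[n]$, whose $j$-th column consists of the consecutive entries $l_j,l_j+1,\ldots,l_j+r$ (top to bottom) for $j=1,\dots,s$, where $l_j+r<l_{j+1}$ for all $j$ and $l_s+r\le n$. Let $N=n-(l_s+r)+(r+1)$. Then $\mathrm{pr}^{N}(T)$ has entries $1,2,\ldots,r+1$ (top to bottom) in its first column, and for $2\le j\le s$ its $j$-th column is obtained from the $(j-1)$-st column of $T$ by adding $N$ to each entry.
   Context: Tableaux in English notation. Promotion $\mathrm{pr}$ of a tableau with entries in $[n]$ (with respect to $n$): remove all entries $n$; processing these empty cells from the bottom one to the top one, slide each to the top-left boundary by reverse jeu de taquin (repeatedly move into the empty cell the larger of the entries immediately above and immediately left; if only one exists move it; if equal move the one above), filling the vacated top-left cells with $0$; then add $1$ to every entry. -}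

module Defs where

open import Data.Nat using (ℕ; zero; suc; pred; _+_; _≡ᵇ_; _≤ᵇ_)
open import Data.Bool using (Bool; true; false; if_then_else_; _∧_)
open import Data.Maybe using (Maybe; just; nothing; maybe)
open import Data.List using (List; []; _∷_; upTo; reverse; map; concatMap; filterᵇ; foldl)
open import Data.Product using (_×_; _,_; proj₁; proj₂)

-- A tableau (English notation) with R rows and C columns is encoded as a
-- function  T : ℕ → ℕ → ℕ,  T i j = entry in row i, column j (0-indexed);
-- only the cells with i < R and j < C are meaningful.
Tableau : Set
Tableau = ℕ → ℕ → ℕ

-- A partially filled grid: nothing = empty cell.
Grid : Set
Grid = ℕ → ℕ → Maybe ℕ

set : Grid → ℕ → ℕ → Maybe ℕ → Grid
set g i j v a b = if (a ≡ᵇ i) ∧ (b ≡ᵇ j) then v else g a b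

above : Grid → ℕ → ℕ → Maybe ℕ
above g zero    j = nothing
above g (suc i) j = g i j

leftOf : Grid → ℕ → ℕ → Maybe ℕ
leftOf g i zero    = nothing
leftOf g i (suc j) = g i j

data Dir : Set where
  up left stop : Dir

choose : Maybe ℕ → Maybe ℕ → Dir
choose (just a) (just b) = if b ≤ᵇ a then up else left
choose (just a) nothing  = up
choose nothing  (just b) = left
choose nothing  nothing  = stop

-- reverse jeu de taquin slide of the empty cell (i , j) to the top-left
-- boundary; the vacated top-left cell is filled with 0.
-- The first argument is fuel; it is always called with fuel i + j,
-- which suffices since each step decreases i + j by one.
slideF : ℕ → Grid → ℕ → ℕ → Grid
slideF zero    g i j = set g i j (just 0)
slideF (suc f) g i j with choose (above g i j) (leftOf g i j)
... | up   = slideF f (set g i j (above g i j)) (pred i) j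
... | left = slideF f (set g i j (leftOf g i j)) i (pred j)
... | stop = set g i j (just 0)

slide : Grid → ℕ × ℕ → Grid
slide g (i , j) = slideF (i + j) g i j

cellsWith : ℕ → ℕ → Tableau → ℕ → List (ℕ × ℕ)
cellsWith R C T n =
  concatMap (λ i → map (λ j → (i , j)) (filterᵇ (λ j → T i j ≡ᵇ n) (upTo C)))
            (reverse (upTo R))

pr : ℕ → ℕ → ℕ → Tableau → Tableau
pr n R C T i j = maybe suc 0 (final i j)
  where
  g₀ : Grid
  g₀ a b = if T a b ≡ᵇ n then nothing else just (T a b)
  final : Grid
  final = foldl slide g₀ (cellsWith R C T n)

iter : {A : Set} → ℕ → (A → A) → A → A
iter zero    f x = x
iter (suc k) f x = f (iter k f x)

-- Let d = n − (l_s + r). In the first d promotions no entry equals n, so each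
-- one only adds 1; afterwards column j holds L_j, …, L_j + r with L_j = l_j + d
-- and L_s + r = n. In each of the next r + 1 promotions the only entry n is the
-- bottom-right one, and the gaps L_j + r < L_{j+1} force its hole along a hook:
-- up the last column to the first row k not yet rotated, left along row k, and
-- up column 0. So row k moves one column to the right with k + 1 entering
-- column 0, the last column below row k moves one row down, and all entries
-- grow by 1.
module Submission where

open import Defs
open import Data.Nat using (ℕ; zero; suc; _+_; _∸_; _≤_; _<_; z≤n; s≤s; _≡ᵇ_)
open import Data.Nat.Properties
open import Data.Bool using (Bool; true; false; T; if_then_else_)
open import Data.Bool.Properties using (∧-zeroʳ)
open import Data.Maybe using (just; nothing; maybe)
open import Data.Maybe.Relation.Unary.All using (All; just; nothing)
open import Data.List using (List; []; _∷_; _++_; [_]; map; concatMap; filterᵇ; upTo; downFrom; reverse; foldl)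
open import Data.List.Properties using (upTo-∷ʳ; filter-++; filter-none; filter-accept; reverse-upTo)
open import Data.List.Relation.Unary.All.Properties using (applyUpTo⁺₁)
open import Data.Product using (_×_; _,_; proj₁; proj₂)
open import Data.Sum using (_⊎_; inj₁; inj₂)
open import Data.Empty using (⊥-elim)
open import Function using (id; _∘_)
open import Relation.Nullary using (¬_; yes; no)
open import Relation.Nullary.Decidable using (T?; dec-true; dec-false)
open import Relation.Binary.PropositionalEquality hiding ([_])
open import Algebra.Properties.CommutativeSemigroup +-commutativeSemigroup using (xy∙z≈xz∙y)

≡ᵇ-refl : ∀ m → (m ≡ᵇ m) ≡ true
≡ᵇ-refl m = dec-true (m ≟ m) refl

≢⇒≡ᵇ≡false : ∀ {m n} → m ≢ n → (m ≡ᵇ n) ≡ false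
≢⇒≡ᵇ≡false {m} {n} = dec-false (m ≟ n)

set-same : ∀ (g : Grid) i j v → set g i j v i j ≡ v
set-same g i j v rewrite ≡ᵇ-refl i | ≡ᵇ-refl j = refl

set-otherRow : ∀ (g : Grid) i j v {a b} → a ≢ i → set g i j v a b ≡ g a b
set-otherRow g i j v a≢i rewrite ≢⇒≡ᵇ≡false a≢i = refl

set-otherColumn : ∀ (g : Grid) i j v {a b} → b ≢ j → set g i j v a b ≡ g a b
set-otherColumn g i j v {a} b≢j rewrite ≢⇒≡ᵇ≡false b≢j | ∧-zeroʳ (a ≡ᵇ i) = refl

leftOf-set : ∀ (g : Grid) i {v} a c → leftOf (set g i c v) a c ≡ leftOf g a c
leftOf-set g i a zero    = refl
leftOf-set g i {v} a (suc c) = set-otherColumn g i (suc c) v (<⇒≢ (n<1+n c))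

above-set : ∀ (g : Grid) {j v} k b → above (set g k j v) k b ≡ above g k b
above-set g zero    b = refl
above-set g {j} {v} (suc k) b = set-otherRow g (suc k) j v (<⇒≢ (n<1+n k))

leftOf-all : ∀ {P : ℕ → Set} (g : Grid) a c → (∀ b → b < c → All P (g a b)) → All P (leftOf g a c)
leftOf-all g a zero    _   = nothing
leftOf-all g a (suc c) all = all c (n<1+n c)

above-all : ∀ {P : ℕ → Set} (g : Grid) k b → (∀ a → a < k → All P (g a b)) → All P (above g k b)
above-all g zero    b _   = nothing
above-all g (suc k) b all = all k (n<1+n k)

all-just : ∀ {P : ℕ → Set} {x? x} → x? ≡ just x → P x → All P x?
all-just refl px = just px

choose-up : ∀ {x? y? x} → x? ≡ just x → All (_≤ x) y? → choose x? y? ≡ up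
choose-up refl nothing = refl
choose-up {x = x} refl (just {y} y≤x) = cong (if_then up else left) (dec-true (y ≤? x) y≤x)

choose-left : ∀ {x? y? y} → y? ≡ just y → All (_< y) x? → choose x? y? ≡ left
choose-left refl nothing = refl
choose-left {y = y} refl (just {x} x<y) = cong (if_then up else left) (dec-false (y ≤? x) (<⇒≱ x<y))

-- moveHoleUp g c k m: the hole at (m + k, c) climbs to (k, c), moving the m
-- entries above it one row down; moveHoleLeft g k j: the hole at (k, j) runs
-- left to (k, 0). The cell finally holding the hole keeps its old entry.
moveHoleUp : Grid → (c k m : ℕ) → Grid
moveHoleUp g c k zero    = g
moveHoleUp g c k (suc m) = moveHoleUp (set g (suc (m + k)) c (g (m + k) c)) c k m

moveHoleLeft : Grid → (k j : ℕ) → Grid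
moveHoleLeft g k zero    = g
moveHoleLeft g k (suc j) = moveHoleLeft (set g k (suc j) (g k j)) k j

slideF-moveHoleUp : ∀ (g : Grid) c k m f →
  (∀ t → t < m → choose (g (t + k) c) (leftOf g (suc (t + k)) c) ≡ up) →
  slideF (m + f) g (m + k) c ≡ slideF f (moveHoleUp g c k m) k c
slideF-moveHoleUp g c k zero    f climbs = refl
slideF-moveHoleUp g c k (suc m) f climbs rewrite climbs m (n<1+n m) =
  slideF-moveHoleUp g′ c k m f climbs′
  where
  g′ : Grid
  g′ = set g (suc (m + k)) c (g (m + k) c)
  climbs′ : ∀ t → t < m → choose (g′ (t + k) c) (leftOf g′ (suc (t + k)) c) ≡ up
  climbs′ t t<m =
    trans (cong₂ choose (set-otherRow g _ c _ (<⇒≢ (s≤s (+-monoˡ-≤ k (<⇒≤ t<m)))))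
                        (leftOf-set g (suc (m + k)) (suc (t + k)) c))
          (climbs t (m<n⇒m<1+n t<m))

slideF-moveHoleLeft : ∀ (g : Grid) k j f →
  (∀ t → t < j → choose (above g k (suc t)) (g k t) ≡ left) →
  slideF (j + f) g k j ≡ slideF f (moveHoleLeft g k j) k 0
slideF-moveHoleLeft g k zero    f moves = refl
slideF-moveHoleLeft g k (suc j) f moves rewrite moves j (n<1+n j) =
  slideF-moveHoleLeft g′ k j f moves′
  where
  g′ : Grid
  g′ = set g k (suc j) (g k j)
  moves′ : ∀ t → t < j → choose (above g′ k (suc t)) (g′ k t) ≡ left
  moves′ t t<j =
    trans (cong₂ choose (above-set g k (suc t)) (set-otherColumn g k _ _ (<⇒≢ (m<n⇒m<1+n t<j))))
          (moves t (m<n⇒m<1+n t<j))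

moveHoleUp-outside : ∀ (g : Grid) c k m {a b} →
  b ≢ c ⊎ a ≤ k ⊎ m + k < a → moveHoleUp g c k m a b ≡ g a b
moveHoleUp-outside g c k zero    out = refl
moveHoleUp-outside g c k (suc m) {a} {b} out =
  trans (moveHoleUp-outside _ c k m (shrink out)) (unmoved out)
  where
  shrink : b ≢ c ⊎ a ≤ k ⊎ suc m + k < a → b ≢ c ⊎ a ≤ k ⊎ m + k < a
  shrink (inj₁ b≢c)         = inj₁ b≢c
  shrink (inj₂ (inj₁ a≤k))  = inj₂ (inj₁ a≤k)
  shrink (inj₂ (inj₂ m+k<a)) = inj₂ (inj₂ (<-trans (n<1+n _) m+k<a))
  unmoved : b ≢ c ⊎ a ≤ k ⊎ suc m + k < a → set g (suc (m + k)) c (g (m + k) c) a b ≡ g a b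
  unmoved (inj₁ b≢c)          = set-otherColumn g _ c _ b≢c
  unmoved (inj₂ (inj₁ a≤k))   = set-otherRow g _ c _ (<⇒≢ (s≤s (≤-trans a≤k (m≤n+m k m))))
  unmoved (inj₂ (inj₂ m+k<a)) = set-otherRow g _ c _ (>⇒≢ m+k<a)

moveHoleUp-inside : ∀ (g : Grid) c k m {a} → k ≤ a → a < m + k →
  moveHoleUp g c k m (suc a) c ≡ g a c
moveHoleUp-inside g c k zero    k≤a a<k = ⊥-elim (<⇒≱ a<k k≤a)
moveHoleUp-inside g c k (suc m) k≤a a<1+m+k with m<1+n⇒m<n∨m≡n a<1+m+k
... | inj₁ a<m+k = trans (moveHoleUp-inside _ c k m k≤a a<m+k)
                         (set-otherRow g _ c _ (<⇒≢ (m<n⇒m<1+n a<m+k)))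
... | inj₂ refl  = trans (moveHoleUp-outside _ c k m (inj₂ (inj₂ (n<1+n _))))
                         (set-same g _ c _)

moveHoleLeft-outside : ∀ (g : Grid) k j {a b} →
  a ≢ k ⊎ b ≡ 0 ⊎ j < b → moveHoleLeft g k j a b ≡ g a b
moveHoleLeft-outside g k zero    out = refl
moveHoleLeft-outside g k (suc j) {a} {b} out =
  trans (moveHoleLeft-outside _ k j (shrink out)) (unmoved out)
  where
  shrink : a ≢ k ⊎ b ≡ 0 ⊎ suc j < b → a ≢ k ⊎ b ≡ 0 ⊎ j < b
  shrink (inj₁ a≢k)        = inj₁ a≢k
  shrink (inj₂ (inj₁ b≡0)) = inj₂ (inj₁ b≡0)
  shrink (inj₂ (inj₂ j<b)) = inj₂ (inj₂ (<-trans (n<1+n j) j<b))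
  unmoved : a ≢ k ⊎ b ≡ 0 ⊎ suc j < b → set g k (suc j) (g k j) a b ≡ g a b
  unmoved (inj₁ a≢k)         = set-otherRow g k _ _ a≢k
  unmoved (inj₂ (inj₁ refl)) = set-otherColumn g k (suc j) _ λ ()
  unmoved (inj₂ (inj₂ j<b))  = set-otherColumn g k _ _ (>⇒≢ j<b)

moveHoleLeft-inside : ∀ (g : Grid) k j {b} → b < j → moveHoleLeft g k j k (suc b) ≡ g k b
moveHoleLeft-inside g k (suc j) b<1+j with m<1+n⇒m<n∨m≡n b<1+j
... | inj₁ b<j = trans (moveHoleLeft-inside _ k j b<j)
                       (set-otherColumn g k _ _ (<⇒≢ (m<n⇒m<1+n b<j)))
... | inj₂ refl = trans (moveHoleLeft-outside _ k j (inj₂ (inj₂ (n<1+n j))))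
                        (set-same g k _ _)

above-moveHoleUp : ∀ (g : Grid) c k m j → above (moveHoleUp g c k m) k j ≡ above g k j
above-moveHoleUp g c zero    m j = refl
above-moveHoleUp g c (suc k) m j = moveHoleUp-outside g c (suc k) m (inj₂ (inj₁ (n≤1+n k)))

module HookSlide (g : Grid) (r c k : ℕ) where

  G₁ G₂ G₃ hook : Grid
  G₁ = moveHoleUp g c k (r ∸ k)
  G₂ = moveHoleLeft G₁ k c
  G₃ = moveHoleUp G₂ 0 0 k
  hook = set G₃ 0 0 (just 0)

  slide-hook : k ≤ r →
    (∀ t → t < r ∸ k → choose (g (t + k) c) (leftOf g (suc (t + k)) c) ≡ up) →
    (∀ t → t < c → choose (above g k (suc t)) (g k t) ≡ left) →
    (∀ t → t < k → choose (g t 0) nothing ≡ up) →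
    slide g (r , c) ≡ hook
  slide-hook k≤r climbs moves climbs₀ = begin
    slideF (r + c) g r c
      ≡⟨ cong₂ (λ f i → slideF f g i c) fuel (sym (m∸n+n≡m k≤r)) ⟩
    slideF (r ∸ k + (c + k)) g (r ∸ k + k) c
      ≡⟨ slideF-moveHoleUp g c k (r ∸ k) (c + k) climbs ⟩
    slideF (c + k) G₁ k c
      ≡⟨ slideF-moveHoleLeft G₁ k c k moves₁ ⟩
    slideF k G₂ k 0
      ≡⟨ cong₂ (λ f i → slideF f G₂ i 0) (sym (+-identityʳ k)) (sym (+-identityʳ k)) ⟩
    slideF (k + 0) G₂ (k + 0) 0
      ≡⟨ slideF-moveHoleUp G₂ 0 0 k 0 climbs₀′ ⟩
    hook ∎
    where
    open ≡-Reasoning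
    fuel : r + c ≡ r ∸ k + (c + k)
    fuel = begin
      r + c               ≡⟨ cong (_+ c) (sym (m∸n+n≡m k≤r)) ⟩
      r ∸ k + k + c       ≡⟨ +-assoc (r ∸ k) k c ⟩
      r ∸ k + (k + c)     ≡⟨ cong (r ∸ k +_) (+-comm k c) ⟩
      r ∸ k + (c + k)     ∎
    moves₁ : ∀ t → t < c → choose (above G₁ k (suc t)) (G₁ k t) ≡ left
    moves₁ t t<c = trans (cong₂ choose (above-moveHoleUp g c k (r ∸ k) (suc t))
                                       (moveHoleUp-outside g c k (r ∸ k) (inj₁ (<⇒≢ t<c))))
                         (moves t t<c)
    climbs₀′ : ∀ t → t < k → choose (G₂ (t + 0) 0) (leftOf G₂ (suc (t + 0)) 0) ≡ up
    climbs₀′ t t<k rewrite +-identityʳ t =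
      trans (cong (λ x → choose x nothing)
                  (trans (moveHoleLeft-outside G₁ k c (inj₂ (inj₁ refl)))
                         (moveHoleUp-outside g c k (r ∸ k) (inj₂ (inj₁ (<⇒≤ t<k))))))
            (climbs₀ t t<k)

  hook-origin : hook 0 0 ≡ just 0
  hook-origin = set-same G₃ 0 0 (just 0)

  hook-firstColumn : ∀ {a} → a < k → hook (suc a) 0 ≡ g a 0
  hook-firstColumn {a} a<k =
    trans (set-otherRow G₃ 0 0 (just 0) λ ())
    (trans (moveHoleUp-inside G₂ 0 0 k z≤n (subst (a <_) (sym (+-identityʳ k)) a<k))
    (trans (moveHoleLeft-outside G₁ k c (inj₂ (inj₁ refl)))
           (moveHoleUp-outside g c k (r ∸ k) (inj₂ (inj₁ (<⇒≤ a<k))))))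

  hook-row : ∀ {b} → b < c → hook k (suc b) ≡ g k b
  hook-row b<c =
    trans (set-otherColumn G₃ 0 0 (just 0) λ ())
    (trans (moveHoleUp-outside G₂ 0 0 k (inj₁ λ ()))
    (trans (moveHoleLeft-inside G₁ k c b<c)
           (moveHoleUp-outside g c k (r ∸ k) (inj₂ (inj₁ ≤-refl)))))

  hook-lastColumn : ∀ {a} → k ≤ a → a < r → hook (suc a) c ≡ g a c
  hook-lastColumn {a} k≤a a<r =
    trans (set-otherRow G₃ 0 0 (just 0) λ ())
    (trans (moveHoleUp-outside G₂ 0 0 k (inj₂ (inj₂ (s≤s (≤-trans (≤-reflexive (+-identityʳ k)) k≤a)))))
    (trans (moveHoleLeft-outside G₁ k c (inj₁ (>⇒≢ (s≤s k≤a))))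
           (moveHoleUp-inside g c k (r ∸ k) k≤a a<r∸k+k)))
    where
    a<r∸k+k : a < r ∸ k + k
    a<r∸k+k = subst (a <_) (sym (m∸n+n≡m (≤-trans k≤a (<⇒≤ a<r)))) a<r

  hook-aboveRow : ∀ {a b} → a < k → hook a (suc b) ≡ g a (suc b)
  hook-aboveRow {a} a<k =
    trans (set-otherColumn G₃ 0 0 (just 0) λ ())
    (trans (moveHoleUp-outside G₂ 0 0 k (inj₁ λ ()))
    (trans (moveHoleLeft-outside G₁ k c (inj₁ (<⇒≢ a<k)))
           (moveHoleUp-outside g c k (r ∸ k) (inj₂ (inj₁ (<⇒≤ a<k))))))

  hook-belowRow : ∀ {a b} → k < a → b < c → hook a b ≡ g a b
  hook-belowRow {a} {b} k<a b<c =
    trans (set-otherRow G₃ 0 0 (just 0) (>⇒≢ (≤-trans (s≤s z≤n) k<a)))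
    (trans (moveHoleUp-outside G₂ 0 0 k (inj₂ (inj₂ (subst (_< a) (sym (+-identityʳ k)) k<a))))
    (trans (moveHoleLeft-outside G₁ k c (inj₁ (>⇒≢ k<a)))
           (moveHoleUp-outside g c k (r ∸ k) (inj₁ (<⇒≢ b<c)))))

filterᵇ-upTo-none : ∀ (p : ℕ → Bool) C → (∀ j → j < C → ¬ T (p j)) → filterᵇ p (upTo C) ≡ []
filterᵇ-upTo-none p C none = filter-none (T? ∘ p) (applyUpTo⁺₁ id C λ {j} → none j)

filterᵇ-upTo-last : ∀ (p : ℕ → Bool) c → (∀ j → j < c → ¬ T (p j)) → T (p c) →
  filterᵇ p (upTo (suc c)) ≡ c ∷ []
filterᵇ-upTo-last p c none last = begin
  filterᵇ p (upTo (suc c))            ≡⟨ cong (filterᵇ p) (sym (upTo-∷ʳ c)) ⟩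
  filterᵇ p (upTo c ++ [ c ])         ≡⟨ filter-++ (T? ∘ p) (upTo c) [ c ] ⟩
  filterᵇ p (upTo c) ++ filterᵇ p [ c ]
    ≡⟨ cong₂ _++_ (filterᵇ-upTo-none p c none) (filter-accept (T? ∘ p) last) ⟩
  c ∷ []                              ∎
  where open ≡-Reasoning

cellsInRow : ℕ → Tableau → ℕ → ℕ → List (ℕ × ℕ)
cellsInRow C T n i = map (λ j → (i , j)) (filterᵇ (λ j → T i j ≡ᵇ n) (upTo C))

cellsWith-suc : ∀ R C T n → cellsWith (suc R) C T n ≡ cellsInRow C T n R ++ cellsWith R C T n
cellsWith-suc R C T n = begin
  concatMap row (reverse (upTo (suc R)))  ≡⟨ cong (concatMap row) (reverse-upTo (suc R)) ⟩
  row R ++ concatMap row (downFrom R)     ≡⟨ cong (λ rows → row R ++ concatMap row rows) (sym (reverse-upTo R)) ⟩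
  row R ++ cellsWith R C T n              ∎
  where
  open ≡-Reasoning
  row : ℕ → List (ℕ × ℕ)
  row = cellsInRow C T n

≢⇒¬T≡ᵇ : ∀ {m n} → m ≢ n → ¬ T (m ≡ᵇ n)
≢⇒¬T≡ᵇ m≢n t = m≢n (≡ᵇ⇒≡ _ _ t)

cellsWith-none : ∀ R C T n → (∀ a b → a < R → b < C → T a b ≢ n) → cellsWith R C T n ≡ []
cellsWith-none zero    C T n none = refl
cellsWith-none (suc R) C T n none = trans (cellsWith-suc R C T n)
  (cong₂ _++_ (cong (map (R ,_)) (filterᵇ-upTo-none _ C λ j j<C → ≢⇒¬T≡ᵇ (none R j (n<1+n R) j<C)))
              (cellsWith-none R C T n λ a b a<R → none a b (m<n⇒m<1+n a<R)))

cellsWith-corner : ∀ r c T n → T r c ≡ n →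
  (∀ a b → a ≤ r → b ≤ c → a < r ⊎ b < c → T a b ≢ n) →
  cellsWith (suc r) (suc c) T n ≡ (r , c) ∷ []
cellsWith-corner r c T n corner others = trans (cellsWith-suc r (suc c) T n)
  (cong₂ _++_ (cong (map (r ,_)) (filterᵇ-upTo-last _ c
                 (λ j j<c → ≢⇒¬T≡ᵇ (others r j ≤-refl (<⇒≤ j<c) (inj₂ j<c)))
                 (≡⇒≡ᵇ _ _ corner)))
              (cellsWith-none r (suc c) T n λ a b a<r b<1+c →
                 others a b (<⇒≤ a<r) (≤-pred b<1+c) (inj₁ a<r)))

-- The grid on which pr performs its slides (the g₀ in its definition).
removeEntries : ℕ → Tableau → Grid
removeEntries n T a b = if T a b ≡ᵇ n then nothing else just (T a b)

removeEntries-≢ : ∀ n T {a b} → T a b ≢ n → removeEntries n T a b ≡ just (T a b)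
removeEntries-≢ n T Tab≢n rewrite ≢⇒≡ᵇ≡false Tab≢n = refl

pr-below-n : ∀ {n R C T} → (∀ a b → a < R → b < C → T a b < n) →
  ∀ {a b} → a < R → b < C → pr n R C T a b ≡ suc (T a b)
pr-below-n {n} {R} {C} {T} small {a} {b} a<R b<C =
  trans (cong (λ cs → maybe suc 0 (foldl slide (removeEntries n T) cs a b))
              (cellsWith-none R C T n λ a b a<R b<C → <⇒≢ (small a b a<R b<C)))
        (cong (maybe suc 0) (removeEntries-≢ n T (<⇒≢ (small a b a<R b<C))))

pr-corner : ∀ {n r c T} → T r c ≡ n →
  (∀ a b → a ≤ r → b ≤ c → a < r ⊎ b < c → T a b ≢ n) →
  ∀ a b → pr n (suc r) (suc c) T a b ≡ maybe suc 0 (slide (removeEntries n T) (r , c) a b)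
pr-corner {n} {r} {c} {T} corner others a b =
  cong (λ cs → maybe suc 0 (foldl slide (removeEntries n T) cs a b))
       (cellsWith-corner r c T n corner others)

iter-+ : ∀ {A : Set} m k (f : A → A) x → iter (m + k) f x ≡ iter m f (iter k f x)
iter-+ zero    k f x = refl
iter-+ (suc m) k f x = cong f (iter-+ m k f x)

iter-pr-below-n : ∀ {n R C T} m → (∀ a b → a < R → b < C → T a b + m ≤ n) →
  ∀ {a b} → a < R → b < C → iter m (pr n R C) T a b ≡ T a b + m
iter-pr-below-n {T = T} zero _ {a} {b} _ _ = sym (+-identityʳ (T a b))
iter-pr-below-n {n} {R} {C} {T} (suc m) small {a} {b} a<R b<C = begin
  pr n R C (iter m (pr n R C) T) a b ≡⟨ pr-below-n small′ a<R b<C ⟩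
  suc (iter m (pr n R C) T a b)      ≡⟨ cong suc (iter-pr-below-n m small″ a<R b<C) ⟩
  suc (T a b + m)                    ≡⟨ sym (+-suc (T a b) m) ⟩
  T a b + suc m                      ∎
  where
  open ≡-Reasoning
  small″ : ∀ a b → a < R → b < C → T a b + m ≤ n
  small″ a b a<R b<C = ≤-trans (+-monoʳ-≤ (T a b) (n≤1+n m)) (small a b a<R b<C)
  small′ : ∀ a b → a < R → b < C → iter m (pr n R C) T a b < n
  small′ a b a<R b<C rewrite iter-pr-below-n m small″ a<R b<C | sym (+-suc (T a b) m) =
    small a b a<R b<C

module ConsecutiveColumns (n r c : ℕ) (L : ℕ → ℕ) (corner : L c + r ≡ n)
                 (gap : ∀ b → b < c → L b + r < L c) (L-pos : 1 ≤ L c) where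

  P : Tableau → Tableau
  P = pr n (suc r) (suc c)

  -- After k promotions the top k rows are shifted one column to the right, with
  -- 1, …, k entering column 0, while the lower rows keep their columns; away from
  -- the last column of the lower rows every entry has grown by k.
  record Stage (k : ℕ) (U : Tableau) : Set where
    field
      top-first   : ∀ a → a < k → U a 0 ≡ suc a
      top-rest    : ∀ a b → a < k → b < c → U a (suc b) ≡ L b + a + k
      bottom-last : ∀ a → k ≤ a → a ≤ r → U a c ≡ L c + a
      bottom-rest : ∀ a b → k ≤ a → a ≤ r → b < c → U a b ≡ L b + a + k

  r<n : r < n
  r<n = subst (r <_) corner (+-monoˡ-≤ r L-pos)

  L+x<n : ∀ b x → b < c → x ≤ r + r → L b + x < n
  L+x<n b x b<c x≤r+r = begin-strict
    L b + x        ≤⟨ +-monoʳ-≤ (L b) x≤r+r ⟩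
    L b + (r + r)  ≡⟨ sym (+-assoc (L b) r r) ⟩
    L b + r + r    <⟨ +-monoˡ-< r (gap b b<c) ⟩
    L c + r        ≡⟨ corner ⟩
    n              ∎
    where open ≤-Reasoning

  module _ {k U} (st : Stage k U) (k≤r : k ≤ r) where
    open Stage st

    top<n : ∀ a b → a < k → b ≤ c → U a b < n
    top<n a zero    a<k _ rewrite top-first a a<k = ≤-<-trans (≤-trans a<k k≤r) r<n
    top<n a (suc b) a<k b<c rewrite top-rest a b a<k b<c | +-assoc (L b) a k =
      L+x<n b (a + k) b<c (+-mono-≤ (<⇒≤ (<-≤-trans a<k k≤r)) k≤r)

    bottom<n : ∀ a b → k ≤ a → a ≤ r → b ≤ c → a < r ⊎ b < c → U a b < n
    bottom<n a b k≤a a≤r b≤c off with m≤n⇒m<n∨m≡n b≤c | off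
    ... | inj₁ b<c | _ rewrite bottom-rest a b k≤a a≤r b<c | +-assoc (L b) a k =
      L+x<n b (a + k) b<c (+-mono-≤ a≤r (≤-trans k≤a a≤r))
    ... | inj₂ refl | inj₁ a<r rewrite bottom-last a k≤a a≤r =
      subst (L c + a <_) corner (+-monoʳ-< (L c) a<r)
    ... | inj₂ refl | inj₂ c<c = ⊥-elim (<-irrefl refl c<c)

    entry<n : ∀ a b → a ≤ r → b ≤ c → a < r ⊎ b < c → U a b < n
    entry<n a b a≤r b≤c off with a <? k
    ... | yes a<k = top<n a b a<k b≤c
    ... | no  a≮k = bottom<n a b (≮⇒≥ a≮k) a≤r b≤c off

    g : Grid
    g = removeEntries n U

    open HookSlide g r c k

    entry : ∀ {a b v} → a ≤ r → b ≤ c → a < r ⊎ b < c → U a b ≡ v → g a b ≡ just v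
    entry {a} {b} a≤r b≤c off refl = removeEntries-≢ n U (<⇒≢ (entry<n a b a≤r b≤c off))

    climbs : ∀ t → t < r ∸ k → choose (g (t + k) c) (leftOf g (suc (t + k)) c) ≡ up
    climbs t t<r∸k =
      choose-up (entry (<⇒≤ x<r) ≤-refl (inj₁ x<r) (bottom-last x (m≤n+m k t) (<⇒≤ x<r)))
                (leftOf-all g (suc x) c λ b b<c →
                   all-just (entry x<r (<⇒≤ b<c) (inj₂ b<c)
                                   (bottom-rest (suc x) b (m≤n⇒m≤1+n (m≤n+m k t)) x<r b<c))
                            (left≤ b b<c))
      where
      x : ℕ
      x = t + k
      x<r : x < r
      x<r = subst (x <_) (m∸n+n≡m k≤r) (+-monoˡ-< k t<r∸k)
      left≤ : ∀ b → b < c → L b + suc x + k ≤ L c + x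
      left≤ b b<c = begin
        L b + suc x + k   ≡⟨ xy∙z≈xz∙y (L b) (suc x) k ⟩
        L b + k + suc x   ≡⟨ +-suc (L b + k) x ⟩
        suc (L b + k) + x ≤⟨ +-monoˡ-≤ x (≤-trans (s≤s (+-monoʳ-≤ (L b) k≤r)) (gap b b<c)) ⟩
        L c + x           ∎
        where open ≤-Reasoning

    moves : ∀ t → t < c → choose (above g k (suc t)) (g k t) ≡ left
    moves t t<c =
      choose-left (entry k≤r (<⇒≤ t<c) (inj₂ t<c) (bottom-rest k t ≤-refl k≤r t<c))
                  (above-all g k (suc t) λ a a<k →
                     all-just (entry (<⇒≤ (<-≤-trans a<k k≤r)) t<c (inj₁ (<-≤-trans a<k k≤r))
                                     (top-rest a t a<k t<c))
                              (+-monoˡ-< k (+-monoʳ-< (L t) a<k)))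

    climbs₀ : ∀ t → t < k → choose (g t 0) nothing ≡ up
    climbs₀ t t<k = choose-up (entry (<⇒≤ t<r) z≤n (inj₁ t<r) refl) nothing
      where
      t<r : t < r
      t<r = <-≤-trans t<k k≤r

    promoted : ∀ a b → P U a b ≡ maybe suc 0 (hook a b)
    promoted a b =
      trans (pr-corner (trans (bottom-last r k≤r ≤-refl) corner)
                       (λ a b a≤r b≤c off → <⇒≢ (entry<n a b a≤r b≤c off)) a b)
            (cong (λ G → maybe suc 0 (G a b)) (slide-hook k≤r climbs moves climbs₀))

    moved : ∀ {a b a′ b′ v} → hook a b ≡ g a′ b′ →
      a′ ≤ r → b′ ≤ c → a′ < r ⊎ b′ < c → U a′ b′ ≡ v → P U a b ≡ suc v
    moved {a} {b} path a′≤r b′≤c off value =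
      trans (promoted a b) (cong (maybe suc 0) (trans path (entry a′≤r b′≤c off value)))

    promote : Stage (suc k) (P U)
    promote = record
      { top-first = top-first′ ; top-rest = top-rest′
      ; bottom-last = bottom-last′ ; bottom-rest = bottom-rest′ }
      where
      top-first′ : ∀ a → a < suc k → P U a 0 ≡ suc a
      top-first′ zero    _         = trans (promoted 0 0) (cong (maybe suc 0) hook-origin)
      top-first′ (suc a) (s≤s a<k) =
        moved (hook-firstColumn a<k) (<⇒≤ a<r) z≤n (inj₁ a<r) (top-first a a<k)
        where
        a<r : a < r
        a<r = <-≤-trans a<k k≤r

      top-rest′ : ∀ a b → a < suc k → b < c → P U a (suc b) ≡ L b + a + suc k
      top-rest′ a b a<1+k b<c with m<1+n⇒m<n∨m≡n a<1+k
      ... | inj₁ a<k = trans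
        (moved (hook-aboveRow a<k) (<⇒≤ (<-≤-trans a<k k≤r)) b<c (inj₁ (<-≤-trans a<k k≤r))
               (top-rest a b a<k b<c))
        (sym (+-suc (L b + a) k))
      ... | inj₂ refl = trans
        (moved (hook-row b<c) k≤r (<⇒≤ b<c) (inj₂ b<c) (bottom-rest a b ≤-refl k≤r b<c))
        (sym (+-suc (L b + a) a))

      bottom-last′ : ∀ a → suc k ≤ a → a ≤ r → P U a c ≡ L c + a
      bottom-last′ (suc a) (s≤s k≤a) a<r = trans
        (moved (hook-lastColumn k≤a a<r) (<⇒≤ a<r) ≤-refl (inj₁ a<r) (bottom-last a k≤a (<⇒≤ a<r)))
        (sym (+-suc (L c) a))

      bottom-rest′ : ∀ a b → suc k ≤ a → a ≤ r → b < c → P U a b ≡ L b + a + suc k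
      bottom-rest′ a b k<a a≤r b<c = trans
        (moved (hook-belowRow k<a b<c) a≤r (<⇒≤ b<c) (inj₂ b<c) (bottom-rest a b (<⇒≤ k<a) a≤r b<c))
        (sym (+-suc (L b + a) k))

  stages : ∀ {U} k → k ≤ suc r → Stage 0 U → Stage k (iter k P U)
  stages zero    _         st = st
  stages (suc k) (s≤s k≤r) st = promote (stages k (m≤n⇒m≤1+n k≤r) st) k≤r

  rotation : ∀ {U} → (∀ a b → a ≤ r → b ≤ c → U a b ≡ L b + a) →
    (∀ a → a ≤ r → iter (suc r) P U a 0 ≡ suc a) ×
    (∀ a b → a ≤ r → b < c → iter (suc r) P U a (suc b) ≡ U a b + suc r)
  rotation {U} columns =
    (λ a a≤r → top-first a (s≤s a≤r)) ,
    (λ a b a≤r b<c → trans (top-rest a b (s≤s a≤r) b<c)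
                           (cong (_+ suc r) (sym (columns a b a≤r (<⇒≤ b<c)))))
    where
    initial : Stage 0 U
    initial = record
      { top-first   = λ _ ()
      ; top-rest    = λ _ _ ()
      ; bottom-last = λ a _ a≤r → columns a c a≤r ≤-refl
      ; bottom-rest = λ a b _ a≤r b<c → trans (columns a b a≤r (<⇒≤ b<c)) (sym (+-identityʳ _)) }
    open Stage (stages (suc r) ≤-refl initial)

iter-pr-columns : ∀ n r c (l : ℕ → ℕ) (T : Tableau) →
  (∀ a b → a ≤ r → b ≤ c → T a b ≡ l b + a) →
  (∀ b → b < c → l b + r < l c) → 1 ≤ l 0 → l c + r ≤ n →
  let N = n ∸ (l c + r) + suc r ; P = pr n (suc r) (suc c) in
  (∀ a → a ≤ r → iter N P T a 0 ≡ suc a) ×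
  (∀ a b → a ≤ r → b < c → iter N P T a (suc b) ≡ T a b + N)
iter-pr-columns n r c l T columns gap l₀-pos fits =
  (λ a a≤r → trans (split a 0) (proj₁ rotated a a≤r)) ,
  (λ a b a≤r b<c → begin
    iter (d + suc r) P T a (suc b)       ≡⟨ split a (suc b) ⟩
    iter (suc r) P (iter d P T) a (suc b) ≡⟨ proj₂ rotated a b a≤r b<c ⟩
    iter d P T a b + suc r               ≡⟨ cong (_+ suc r) (after-d (s≤s a≤r) (s≤s (<⇒≤ b<c))) ⟩
    T a b + d + suc r                    ≡⟨ +-assoc (T a b) d (suc r) ⟩
    T a b + (d + suc r)                  ∎)
  where
  open ≡-Reasoning
  d : ℕ
  d = n ∸ (l c + r)
  lc+r+d≡n : l c + r + d ≡ n
  lc+r+d≡n = m+[n∸m]≡n fits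
  l≤lc : ∀ b → b ≤ c → l b ≤ l c
  l≤lc b b≤c with m≤n⇒m<n∨m≡n b≤c
  ... | inj₁ b<c  = ≤-trans (m≤m+n (l b) r) (<⇒≤ (gap b b<c))
  ... | inj₂ refl = ≤-refl

  open ConsecutiveColumns n r c (λ j → l j + d)
    (trans (xy∙z≈xz∙y (l c) d r) lc+r+d≡n)
    (λ b b<c → subst (_< l c + d) (xy∙z≈xz∙y (l b) r d) (+-monoˡ-< d (gap b b<c)))
    (≤-trans l₀-pos (≤-trans (l≤lc 0 z≤n) (m≤m+n (l c) d)))

  entries+d≤n : ∀ a b → a < suc r → b < suc c → T a b + d ≤ n
  entries+d≤n a b (s≤s a≤r) (s≤s b≤c) rewrite columns a b a≤r b≤c =
    ≤-trans (+-monoˡ-≤ d (+-mono-≤ (l≤lc b b≤c) a≤r)) (≤-reflexive lc+r+d≡n)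

  after-d : ∀ {a b} → a < suc r → b < suc c → iter d P T a b ≡ T a b + d
  after-d = iter-pr-below-n d entries+d≤n

  rotated : (∀ a → a ≤ r → iter (suc r) P (iter d P T) a 0 ≡ suc a) ×
            (∀ a b → a ≤ r → b < c → iter (suc r) P (iter d P T) a (suc b) ≡ iter d P T a b + suc r)
  rotated = rotation λ a b a≤r b≤c → begin
    iter d P T a b ≡⟨ after-d (s≤s a≤r) (s≤s b≤c) ⟩
    T a b + d      ≡⟨ cong (_+ d) (columns a b a≤r b≤c) ⟩
    l b + a + d    ≡⟨ xy∙z≈xz∙y (l b) a d ⟩
    l b + d + a    ∎

  split : ∀ a b → iter (d + suc r) P T a b ≡ iter (suc r) P (iter d P T) a b
  split a b = cong (λ U → U a b)
    (trans (cong (λ m → iter m P T) (+-comm d (suc r))) (iter-+ (suc r) d P T))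

consecutiveGaps⇒gap : ∀ (l : ℕ → ℕ) r {s} → (∀ j → suc j < s → l j + r < l (suc j)) →
  ∀ {b j} → b < j → j < s → l b + r < l j
consecutiveGaps⇒gap l r gaps {b} {suc j} b<1+j 1+j<s with m<1+n⇒m<n∨m≡n b<1+j
... | inj₂ refl = gaps b 1+j<s
... | inj₁ b<j  = <-trans (consecutiveGaps⇒gap l r gaps b<j (<-trans (n<1+n j) 1+j<s))
                          (≤-<-trans (m≤m+n (l j) r) (gaps j 1+j<s))

lemma4p11 : (n r s : ℕ) (l : ℕ → ℕ) (T : Tableau) →
    1 ≤ s →
    (∀ i j → i ≤ r → j < s → T i j ≡ l j + i) →
    1 ≤ l 0 →
    (∀ j → suc j < s → l j + r < l (suc j)) →
    l (s ∸ 1) + r ≤ n →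
    ((∀ i → i ≤ r →
        iter (n ∸ (l (s ∸ 1) + r) + (r + 1)) (pr n (r + 1) s) T i 0 ≡ i + 1)
     × (∀ i j → i ≤ r → suc j < s →
        iter (n ∸ (l (s ∸ 1) + r) + (r + 1)) (pr n (r + 1) s) T i (suc j)
          ≡ T i j + (n ∸ (l (s ∸ 1) + r) + (r + 1))))
lemma4p11 n r zero    l T () _ _ _ _
lemma4p11 n r (suc c) l T _ table l₀-pos gaps fits rewrite +-comm r 1
  with iter-pr-columns n r c l T (λ a b a≤r b≤c → table a b a≤r (s≤s b≤c))
         (λ b b<c → consecutiveGaps⇒gap l r gaps b<c (n<1+n c)) l₀-pos fits
... | first , rest =
  (λ i i≤r → trans (first i i≤r) (+-comm 1 i)) ,
  (λ i j i≤r 1+j<s → rest i j i≤r (≤-pred 1+j<s))
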